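{- Let $p$ be an odd prime, $v$ a primitive root modulo $p$ with $2\le v\le p-1$, $G_p=\mathrm{Gal}(\mathbb{Q}(\zeta_p)/\mathbb{Q})$, and $\sigma\in G_p$ with $\sigma(\zeta_p)=\zeta_p^v$ (so $\sigma^{p-1}=1$). Let $P(\sigma)=\sum_{i=0}^{p-2}v_{ -i}\sigma^i\in\mathbb{Z}[G_p]$. Then $$P(\sigma)\,(\sigma-v)=p\,Q(\sigma),\qquad Q(\sigma)=\sum_{i=1}^{p-2}\delta_i\sigma^i\in\mathbb{Z}[G_p],$$ where $\delta_i=\dfrac{v_{ -(i-1)}-v_{ -i}\,v}{p}$ for $i=1,\dots,p-2$; moreover each $\delta_i$ is an integer with $-p<\delta_i\le 0$.
   Context: For $n\in\mathbb{Z}$, $v_n$ denotes the unique integer with $1\le v_n\le p-1$ and $v_n\equiv v^n\pmod p$. -}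

module Defs where

open import Data.Nat as ℕ using (ℕ; zero; suc; _∸_; _≡ᵇ_)
open import Data.Nat.Primality using (Prime)
open import Data.Nat.DivMod using (_%_)
open import Data.Integer as ℤ using (ℤ; +_; -[1+_]; _+_; _*_; _-_; -_; _^_; _≤_; _<_)
open import Data.Integer.Divisibility using (_∣_)
open import Data.Bool using (if_then_else_)
open import Data.Product using (_×_)
open import Relation.Binary.PropositionalEquality using (_≡_; _≢_)

IsPrimitiveRoot : ℕ → ℕ → Set
IsPrimitiveRoot p v =
  ((+ p) ∣ ((+ v) ^ (p ∸ 1) - + 1)) ×
  (∀ k → 0 ℕ.< k → k ℕ.< p ∸ 1 → ¬∣ k)
  where
  ¬∣ : ℕ → Set
  ¬∣ k = ((+ p) ∣ ((+ v) ^ k - + 1)) → Data.Empty.⊥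
    where import Data.Empty

-- x ≡ v^n (mod p) for n ∈ ℤ (negative powers read in (ℤ/p)^×)
PowCong : ℕ → ℕ → ℤ → ℤ → Set
PowCong p v (+ m)      x = (+ p) ∣ (x - (+ v) ^ m)
PowCong p v -[1+ m ]   x = (+ p) ∣ (x * (+ v) ^ (suc m) - + 1)

-- w n = v_n : the unique integer with 1 ≤ v_n ≤ p-1 and v_n ≡ v^n (mod p)
IsResidueRep : ℕ → ℕ → (ℤ → ℤ) → Set
IsResidueRep p v w =
  ∀ n → (+ 1 ≤ w n) × (w n ≤ + (p ∸ 1)) × PowCong p v n (w n)

-- Elements of ℤ[C_n] (C_n cyclic of order n generated by σ) are given by
-- coefficient functions f, with f i the coefficient of σ^i, for i < n
-- (values at i ≥ n are ignored).
GroupRing : Set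
GroupRing = ℕ → ℤ

sumTo : ℕ → (ℕ → ℤ) → ℤ
sumTo zero    f = + 0
sumTo (suc n) f = sumTo n f + f n

-- indicator of σ^i σ^j = σ^k in C_n, for i j k < n
hits : ℕ → ℕ → ℕ → ℕ → ℤ
hits n i j k =
  (if (i ℕ.+ j) ≡ᵇ k then + 1 else + 0) + (if (i ℕ.+ j) ≡ᵇ (k ℕ.+ n) then + 1 else + 0)

mul : ℕ → GroupRing → GroupRing → GroupRing
mul n f g k = sumTo n (λ i → sumTo n (λ j → hits n i j k * (f i * g j)))

scale : ℤ → GroupRing → GroupRing
scale c f i = c * f i

_≈[_]_ : GroupRing → ℕ → GroupRing → Set
f ≈[ n ] g = ∀ k → k ℕ.< n → f k ≡ g k

sigmaMinus : ℤ → GroupRing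
sigmaMinus c i = if i ≡ᵇ 1 then + 1 else (if i ≡ᵇ 0 then - c else + 0)

poly : ℕ → ℕ → (ℕ → ℤ) → GroupRing
poly lo hi a i = if (lo ℕ.≤ᵇ i) Data.Bool.∧ (i ℕ.≤ᵇ hi) then a i else + 0
  where import Data.Bool

-- Write a_i = v_{-i}. Since a_i v^i ≡ 1 (mod p) for every i, a_{i-1} ≡ a_i v, so each
-- a_{i-1} - a_i v is p δ_i for an integer δ_i; as 1 ≤ a_{i-1} ≤ p - 1 and 0 < a_i v < p²,
-- this forces -p < δ_i ≤ 0. Multiplying by σ - v shifts coefficients cyclically, so the
-- coefficient of σ^k in P(σ)(σ - v) is a_{k-1} - a_k v = p δ_k for k ≥ 1, and
-- a_{p-2} - a_0 v = v - v = 0 for k = 0, because a_0 = 1 and v^{p-1} ≡ 1 gives a_{p-2} = v.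
module Submission where

open import Defs
open import Algebra.Properties.CommutativeSemigroup using (interchange)
open import Data.Bool using (if_then_else_; _∧_)
open import Data.Nat as ℕ using (ℕ; zero; suc; _∸_; _≡ᵇ_; z≤n; s≤s)
open import Data.Nat.Divisibility as ℕD using ()
open import Data.Nat.Primality using (Prime)
open import Data.Integer as ℤ using (ℤ; +_; -[1+_]; -_; _+_; _*_; _-_; _^_; _<_; _≤_; _⊖_; +<+)
open import Data.Integer.Divisibility.Signed
  using (_∣_; quotient; ∣ᵤ⇒∣; ∣⇒∣ᵤ; ∣m∣n⇒∣m+n; ∣m∣n⇒∣m-n; ∣m⇒∣-m; ∣n⇒∣m*n)
open import Data.Integer.Solver using (module +-*-Solver)
open import Function using (_∘_)
open import Data.Product using (_×_; Σ; _,_; proj₁; proj₂)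
open import Data.Sum using (_⊎_; inj₁; inj₂)
open import Relation.Binary.PropositionalEquality
open import Relation.Nullary using (¬_; yes; no; contradiction)
open import Relation.Nullary.Decidable using (dec-true; dec-false)
import Data.Nat.Properties as ℕP
import Data.Integer.Properties as ℤP

open +-*-Solver using (solve; _:+_; _:*_; _:-_; :-_; con; _:=_)
open _∣_ using (equality)

sumTo-cong : ∀ n {f g : ℕ → ℤ} → (∀ i → i ℕ.< n → f i ≡ g i) → sumTo n f ≡ sumTo n g
sumTo-cong zero    f≗g = refl
sumTo-cong (suc n) f≗g =
  cong₂ _+_ (sumTo-cong n (λ i i<n → f≗g i (ℕP.m<n⇒m<1+n i<n))) (f≗g n ℕP.≤-refl)

sumTo-+ : ∀ n (f g : ℕ → ℤ) → sumTo n (λ i → f i + g i) ≡ sumTo n f + sumTo n g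
sumTo-+ zero    f g = refl
sumTo-+ (suc n) f g = trans (cong (_+ (f n + g n)) (sumTo-+ n f g))
  (interchange ℤP.+-commutativeSemigroup (sumTo n f) (sumTo n g) (f n) (g n))

sumTo-zero : ∀ n (f : ℕ → ℤ) → (∀ i → i ℕ.< n → f i ≡ + 0) → sumTo n f ≡ + 0
sumTo-zero zero    f f≗0 = refl
sumTo-zero (suc n) f f≗0 =
  cong₂ _+_ (sumTo-zero n f (λ i i<n → f≗0 i (ℕP.m<n⇒m<1+n i<n))) (f≗0 n ℕP.≤-refl)

sumTo-single : ∀ n (f : ℕ → ℤ) m → m ℕ.< n → (∀ i → i ℕ.< n → i ≢ m → f i ≡ + 0) →
               sumTo n f ≡ f m
sumTo-single zero    f m ()
sumTo-single (suc n) f m m<1+n f≗0 with m ℕP.≟ n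
... | yes refl = trans (cong (_+ f m) (sumTo-zero n f λ i i<n → f≗0 i (ℕP.m<n⇒m<1+n i<n)
                                                          λ { refl → ℕP.<-irrefl refl i<n }))
                       (ℤP.+-identityˡ (f m))
... | no m≢n = trans (cong₂ _+_ (sumTo-single n f m (ℕP.≤∧≢⇒< (ℕP.≤-pred m<1+n) m≢n)
                                   λ i i<n → f≗0 i (ℕP.m<n⇒m<1+n i<n))
                                (f≗0 n ℕP.≤-refl (m≢n ∘ sym)))
                     (ℤP.+-identityʳ (f m))

sumTo-first-two : ∀ m (f : ℕ → ℤ) → (∀ j → f (suc (suc j)) ≡ + 0) →
                  sumTo (suc (suc m)) f ≡ f 0 + f 1
sumTo-first-two zero    f f≗0 = cong (_+ f 1) (ℤP.+-identityˡ (f 0))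
sumTo-first-two (suc m) f f≗0 =
  trans (cong₂ _+_ (sumTo-first-two m f f≗0) (f≗0 m)) (ℤP.+-identityʳ (f 0 + f 1))

if-≡ᵇ-true : ∀ {m n} {A : Set} {x y : A} → m ≡ n → (if m ≡ᵇ n then x else y) ≡ x
if-≡ᵇ-true {m} {n} {x = x} {y} m≡n =
  cong (λ b → if b then x else y) (dec-true (m ℕP.≟ n) m≡n)

if-≡ᵇ-false : ∀ {m n} {A : Set} {x y : A} → m ≢ n → (if m ≡ᵇ n then x else y) ≡ y
if-≡ᵇ-false {m} {n} {x = x} {y} m≢n =
  cong (λ b → if b then x else y) (dec-false (m ℕP.≟ n) m≢n)

Hit : ℕ → ℕ → ℕ → ℕ → Set
Hit n i j k = i ℕ.+ j ≡ k ⊎ i ℕ.+ j ≡ k ℕ.+ n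

hits-miss : ∀ n i j k → ¬ Hit n i j k → hits n i j k ≡ + 0
hits-miss n i j k miss = cong₂ _+_ (if-≡ᵇ-false (miss ∘ inj₁)) (if-≡ᵇ-false (miss ∘ inj₂))

hits-hit : ∀ n i j k → 0 ℕ.< n → Hit n i j k → hits n i j k ≡ + 1
hits-hit n i j k 0<n (inj₁ e) =
  cong₂ _+_ (if-≡ᵇ-true e) (if-≡ᵇ-false λ e′ → ℕP.<-irrefl (trans (sym e) e′) (ℕP.m<m+n k 0<n))
hits-hit n i j k 0<n (inj₂ e) =
  cong₂ _+_ (if-≡ᵇ-false λ e′ → ℕP.<-irrefl (trans (sym e′) e) (ℕP.m<m+n k 0<n)) (if-≡ᵇ-true e)

¬Hit-twice : ∀ {n i i′ j k} → i′ ℕ.< n → i ℕ.+ j ≡ k → i′ ℕ.+ j ≢ k ℕ.+ n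
¬Hit-twice {n} {i} {i′} {j} {k} i′<n e e′ = ℕP.<-irrefl e′ (begin-strict
  i′ ℕ.+ j <⟨ ℕP.+-mono-<-≤ i′<n (subst (j ℕ.≤_) e (ℕP.m≤n+m j i)) ⟩
  n ℕ.+ k  ≡⟨ ℕP.+-comm n k ⟩
  k ℕ.+ n  ∎)
  where open ℕP.≤-Reasoning

Hit-unique : ∀ {n i i′ j k} → i ℕ.< n → i′ ℕ.< n → Hit n i j k → Hit n i′ j k → i ≡ i′
Hit-unique {j = j} _   _    (inj₁ e) (inj₁ e′) = ℕP.+-cancelʳ-≡ j _ _ (trans e (sym e′))
Hit-unique {j = j} _   _    (inj₂ e) (inj₂ e′) = ℕP.+-cancelʳ-≡ j _ _ (trans e (sym e′))
Hit-unique         _   i′<n (inj₁ e) (inj₂ e′) = contradiction e′ (¬Hit-twice i′<n e)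
Hit-unique         i<n _    (inj₂ e) (inj₁ e′) = contradiction e (¬Hit-twice i<n e′)

sumTo-hits : ∀ n j k i₀ (F : ℕ → ℤ) → i₀ ℕ.< n → Hit n i₀ j k →
             sumTo n (λ i → hits n i j k * F i) ≡ F i₀
sumTo-hits n j k i₀ F i₀<n hit = begin
  sumTo n (λ i → hits n i j k * F i) ≡⟨ sumTo-single n _ i₀ i₀<n off ⟩
  hits n i₀ j k * F i₀               ≡⟨ cong (_* F i₀) (hits-hit n i₀ j k 0<n hit) ⟩
  + 1 * F i₀                         ≡⟨ ℤP.*-identityˡ (F i₀) ⟩
  F i₀                               ∎
  where
  open ≡-Reasoning
  0<n : 0 ℕ.< n
  0<n = ℕP.≤-<-trans z≤n i₀<n
  off : ∀ i → i ℕ.< n → i ≢ i₀ → hits n i j k * F i ≡ + 0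
  off i i<n i≢i₀ =
    trans (cong (_* F i) (hits-miss n i j k λ hitᵢ → i≢i₀ (Hit-unique i<n i₀<n hitᵢ hit)))
          (ℤP.*-zeroˡ (F i))

mul-sigmaMinus : ∀ m c (f : GroupRing) k k⁻ → k ℕ.< suc (suc m) → k⁻ ℕ.< suc (suc m) →
                 Hit (suc (suc m)) k⁻ 1 k → mul (suc (suc m)) f (sigmaMinus c) k ≡ f k⁻ - f k * c
mul-sigmaMinus m c f k k⁻ k<n k⁻<n hit = begin
  mul n f g k
    ≡⟨ sumTo-cong n (λ i _ → sumTo-first-two m _ λ j →
         trans (cong (hits n i (suc (suc j)) k *_) (ℤP.*-zeroʳ (f i)))
               (ℤP.*-zeroʳ (hits n i (suc (suc j)) k))) ⟩
  sumTo n (λ i → hits n i 0 k * (f i * g 0) + hits n i 1 k * (f i * g 1))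
    ≡⟨ sumTo-+ n _ _ ⟩
  sumTo n (λ i → hits n i 0 k * (f i * g 0)) + sumTo n (λ i → hits n i 1 k * (f i * g 1))
    ≡⟨ cong₂ _+_ (sumTo-hits n 0 k k _ k<n (inj₁ (ℕP.+-identityʳ k)))
                 (sumTo-hits n 1 k k⁻ _ k⁻<n hit) ⟩
  f k * - c + f k⁻ * + 1
    ≡⟨ solve 3 (λ x y c → x :* (:- c) :+ y :* con (+ 1) := y :- x :* c) refl (f k) (f k⁻) c ⟩
  f k⁻ - f k * c
    ∎
  where
  open ≡-Reasoning
  n : ℕ
  n = suc (suc m)
  g : GroupRing
  g = sigmaMinus c

poly-inside : ∀ lo hi (a : ℕ → ℤ) i → lo ℕ.≤ i → i ℕ.≤ hi → poly lo hi a i ≡ a i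
poly-inside lo hi a i lo≤i i≤hi = cong (λ b → if b then a i else + 0)
  (cong₂ _∧_ (dec-true (lo ℕP.≤? i) lo≤i) (dec-true (i ℕP.≤? hi) i≤hi))


∣-inverse-shift : ∀ {P} X Y U V → P ∣ X * U - + 1 → P ∣ Y * (V * U) - + 1 → P ∣ X - Y * V
∣-inverse-shift {P} X Y U V P∣XU-1 P∣YVU-1 =
  subst (P ∣_) (sym (identity X Y U V))
        (∣m∣n⇒∣m+n (∣n⇒∣m*n (X - Y * V) (∣m⇒∣-m P∣XU-1))
                   (∣n⇒∣m*n X (∣m∣n⇒∣m-n P∣XU-1 P∣YVU-1)))
  where
  identity : ∀ X Y U V →
             X - Y * V ≡ (X - Y * V) * - (X * U - + 1) + X * ((X * U - + 1) - (Y * (V * U) - + 1))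
  identity = solve 4 (λ X Y U V → X :- Y :* V
    := (X :- Y :* V) :* (:- (X :* U :- con (+ 1)))
       :+ X :* ((X :* U :- con (+ 1)) :- (Y :* (V :* U) :- con (+ 1))))
    refl

∣-<⇒≡0 : ∀ {m n} → n ℕD.∣ m → m ℕ.< n → m ≡ 0
∣-<⇒≡0 {zero}  _   _   = refl
∣-<⇒≡0 {suc m} n∣m m<n = contradiction n∣m (ℕD.>⇒∤ m<n)

residue-unique : ∀ {P x y} → x ℕ.< P → y ℕ.< P → + P ∣ + x - + y → x ≡ y
residue-unique {P} {x} {y} x<P y<P P∣x-y =
  ℤP.+-injective (ℤP.i-j≡0⇒i≡j (+ x) (+ y) (ℤP.∣i∣≡0⇒i≡0 (∣-<⇒≡0 (∣⇒∣ᵤ P∣x-y) ∣x-y∣<P)))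
  where
  open ℕP.≤-Reasoning
  ∣x-y∣<P : ℤ.∣ + x - + y ∣ ℕ.< P
  ∣x-y∣<P = begin-strict
    ℤ.∣ + x - + y ∣ ≡⟨ cong ℤ.∣_∣ (ℤP.m-n≡m⊖n x y) ⟩
    ℤ.∣ x ⊖ y ∣     ≤⟨ ℤP.∣m⊝n∣≤m⊔n x y ⟩
    x ℕ.⊔ y         <⟨ ℕP.⊔-pres-<m x<P y<P ⟩
    P               ∎

quotient-bounds : ∀ {P x y c} q → x ℕ.< P → y ℕ.< P → c ℕ.< P →
                  + P * q ≡ + x - + y * + c → - (+ P) < q × q ≤ + 0
quotient-bounds {P} {x} {y} {c} q x<P y<P c<P Pq≡x-yc = lower , upper
  where
  open ℤP.≤-Reasoning
  Pq≡ : + P * q ≡ + x - + (y ℕ.* c)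
  Pq≡ = trans Pq≡x-yc (cong (λ t → + x - t) (sym (ℤP.pos-* y c)))
  lower : - (+ P) < q
  lower = ℤP.*-cancelˡ-<-nonNeg (+ P) (begin-strict
    + P * - (+ P)        ≡⟨ sym (ℤP.neg-distribʳ-* (+ P) (+ P)) ⟩
    - (+ P * + P)        ≡⟨ cong -_ (sym (ℤP.pos-* P P)) ⟩
    - (+ (P ℕ.* P))      <⟨ ℤP.neg-mono-< (+<+ (ℕP.*-mono-< y<P c<P)) ⟩
    - (+ (y ℕ.* c))      ≤⟨ ℤP.i≤j+i _ (+ x) ⟩
    + x - + (y ℕ.* c)    ≡⟨ sym Pq≡ ⟩
    + P * q              ∎)
  upper : q ≤ + 0
  upper = ℤP.i<j⇒i≤pred[j] (ℤP.*-cancelˡ-<-nonNeg (+ P) (begin-strict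
    + P * q              ≡⟨ Pq≡ ⟩
    + x - + (y ℕ.* c)    ≤⟨ ℤP.i-j≤i (+ x) (+ (y ℕ.* c)) ⟩
    + x                  <⟨ +<+ x<P ⟩
    + P                  ≡⟨ sym (ℤP.*-identityʳ (+ P)) ⟩
    + P * + 1            ∎))

module InversePowers (m v : ℕ) (v<p : v ℕ.< suc (suc (suc m)))
  (fermat : + suc (suc (suc m)) ∣ (+ v) ^ suc (suc m) - + 1)
  (w : ℤ → ℤ) (rep : IsResidueRep (suc (suc (suc m))) v w) where

  p : ℕ
  p = suc (suc (suc m))

  a : ℕ → ℤ
  a i = w (- (+ i))

  a-natural : ∀ i → Σ ℕ λ x → a i ≡ + x × x ℕ.< p
  a-natural i = natural (proj₁ (rep (- (+ i)))) (proj₁ (proj₂ (rep (- (+ i)))))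
    where
    natural : ∀ {X} → + 1 ≤ X → X ≤ + suc (suc m) → Σ ℕ λ x → X ≡ + x × x ℕ.< p
    natural (ℤ.+≤+ _) (ℤ.+≤+ x≤) = _ , refl , s≤s x≤

  a-unique : ∀ i {c} → c ℕ.< p → + p ∣ a i - + c → a i ≡ + c
  a-unique i {c} c<p p∣aᵢ-c with a-natural i
  ... | x , aᵢ≡x , x<p =
    trans aᵢ≡x (cong +_ (residue-unique x<p c<p (subst (λ t → + p ∣ t - + c) aᵢ≡x p∣aᵢ-c)))

  a-inverts-power : ∀ i → + p ∣ a i * (+ v) ^ i - + 1
  a-inverts-power zero    = subst (λ t → + p ∣ t - + 1) (sym (ℤP.*-identityʳ (a 0)))
                                  (∣ᵤ⇒∣ (proj₂ (proj₂ (rep (+ 0)))))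
  a-inverts-power (suc i) = ∣ᵤ⇒∣ (proj₂ (proj₂ (rep -[1+ i ])))

  a-shift : ∀ i → + p ∣ a i - a (suc i) * + v
  a-shift i =
    ∣-inverse-shift (a i) (a (suc i)) ((+ v) ^ i) (+ v) (a-inverts-power i) (a-inverts-power (suc i))

  a₀≡1 : a 0 ≡ + 1
  a₀≡1 = a-unique 0 (s≤s (s≤s z≤n)) (∣ᵤ⇒∣ (proj₂ (proj₂ (rep (+ 0)))))

  -- Both a_{p-2} and v invert v^{p-2}, the latter by fermat.
  a[p-2]≡v : a (suc m) ≡ + v
  a[p-2]≡v = a-unique (suc m) v<p (subst (λ t → + p ∣ a (suc m) - t) (ℤP.*-identityˡ (+ v))
    (∣-inverse-shift (a (suc m)) (+ 1) ((+ v) ^ suc m) (+ v) (a-inverts-power (suc m))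
                     (subst (λ t → + p ∣ t - + 1) (sym (ℤP.*-identityˡ ((+ v) ^ suc (suc m)))) fermat)))

  -- δ 0 is never read: poly 1 _ δ ignores index 0.
  δ : ℕ → ℤ
  δ zero    = + 0
  δ (suc i) = quotient (a-shift i)

  p*δ : ∀ i → + p * δ (suc i) ≡ a i - a (suc i) * + v
  p*δ i = trans (ℤP.*-comm (+ p) (δ (suc i))) (sym (equality (a-shift i)))

  δ-bounds : ∀ i → - (+ p) < δ (suc i) × δ (suc i) ≤ + 0
  δ-bounds i with a-natural i | a-natural (suc i)
  ... | x , aᵢ≡x , x<p | y , aᵢ₊₁≡y , y<p = quotient-bounds (δ (suc i)) x<p y<p v<p
    (trans (p*δ i) (cong₂ (λ s t → s - t * + v) aᵢ≡x aᵢ₊₁≡y))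

  Pσ : GroupRing
  Pσ = poly 0 (suc m) a

  Pσ-coefficient : ∀ i → i ℕ.≤ suc m → Pσ i ≡ a i
  Pσ-coefficient i = poly-inside 0 (suc m) a i z≤n

  Pσ[σ-v]≈pQσ : mul (suc (suc m)) Pσ (sigmaMinus (+ v))
                  ≈[ suc (suc m) ] scale (+ p) (poly 1 (suc m) δ)
  Pσ[σ-v]≈pQσ zero _ = begin
    mul (suc (suc m)) Pσ (sigmaMinus (+ v)) 0
      ≡⟨ mul-sigmaMinus m (+ v) Pσ 0 (suc m) (s≤s z≤n) ℕP.≤-refl (inj₂ (ℕP.+-comm (suc m) 1)) ⟩
    Pσ (suc m) - Pσ 0 * + v
      ≡⟨ cong₂ (λ s t → s - t * + v) (Pσ-coefficient (suc m) ℕP.≤-refl) (Pσ-coefficient 0 z≤n) ⟩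
    a (suc m) - a 0 * + v
      ≡⟨ cong₂ (λ s t → s - t * + v) a[p-2]≡v a₀≡1 ⟩
    + v - + 1 * + v
      ≡⟨ cong (λ t → + v - t) (ℤP.*-identityˡ (+ v)) ⟩
    + v - + v
      ≡⟨ ℤP.+-inverseʳ (+ v) ⟩
    + 0
      ≡⟨ sym (ℤP.*-zeroʳ (+ p)) ⟩
    + p * + 0
      ∎
    where open ≡-Reasoning
  Pσ[σ-v]≈pQσ (suc k) k+1<m+2 = begin
    mul (suc (suc m)) Pσ (sigmaMinus (+ v)) (suc k)
      ≡⟨ mul-sigmaMinus m (+ v) Pσ (suc k) k k+1<m+2 (ℕP.<-trans (ℕP.n<1+n k) k+1<m+2)
                        (inj₁ (ℕP.+-comm k 1)) ⟩
    Pσ k - Pσ (suc k) * + v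
      ≡⟨ cong₂ (λ s t → s - t * + v) (Pσ-coefficient k (ℕP.<⇒≤ k<m+1)) (Pσ-coefficient (suc k) k<m+1) ⟩
    a k - a (suc k) * + v
      ≡⟨ sym (p*δ k) ⟩
    + p * δ (suc k)
      ≡⟨ cong (+ p *_) (sym (poly-inside 1 (suc m) δ (suc k) (s≤s z≤n) k<m+1)) ⟩
    + p * poly 1 (suc m) δ (suc k)
      ∎
    where
    open ≡-Reasoning
    k<m+1 : suc k ℕ.≤ suc m
    k<m+1 = ℕP.≤-pred k+1<m+2

mainTheorem5 : (p v : ℕ) → Prime p → 3 ℕ.≤ p → 2 ℕ.≤ v → v ℕ.≤ p ∸ 1 →
    IsPrimitiveRoot p v →
    (w : ℤ → ℤ) → IsResidueRep p v w →
    Σ (ℕ → ℤ) (λ δ →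
      (∀ i → 1 ℕ.≤ i → i ℕ.≤ p ∸ 2 →
        (+ p * δ i ≡ w (- (+ (i ∸ 1))) - w (- (+ i)) * + v)
        × (- (+ p) < δ i) × (δ i ≤ + 0))
      × (mul (p ∸ 1) (poly 0 (p ∸ 2) (λ i → w (- (+ i)))) (sigmaMinus (+ v))
          ≈[ p ∸ 1 ] scale (+ p) (poly 1 (p ∸ 2) δ)))
mainTheorem5 (suc (suc zero)) _ _ (s≤s (s≤s ())) _ _ _ _ _
mainTheorem5 (suc (suc (suc m))) v _ _ _ v≤p-1 (p∣v^[p-1]-1 , _) w rep =
  δ , (λ { zero () _ ; (suc i) _ _ → p*δ i , δ-bounds i }) , Pσ[σ-v]≈pQσ
  where open InversePowers m v (s≤s v≤p-1) (∣ᵤ⇒∣ p∣v^[p-1]-1) w rep
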